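{- Let $G$ be a graph with $\mathcal{I}(G)\cong H$. Then for every integer $k\ge i(G)$ there exists a graph $G^*$ with $i(G^*)=k$ and $\mathcal{I}(G^*)\cong H$.
   Context: All graphs are finite and simple. For a graph $G$, $i(G)$ denotes the minimum cardinality of an independent dominating set of $G$; an independent dominating set of cardinality $i(G)$ is an $i$-set of $G$. The $i$-graph $\mathcal{I}(G)$ of $G$ is the graph whose vertices are the $i$-sets of $G$, where two $i$-sets $S$ and $S'$ are adjacent if and only if there is an edge $xy\in E(G)$ with $S'=(S-\{x\})\cup\{y\}$. -}

module Defs where

open import Data.Nat using (ℕ; _≤_)
open import Data.Bool using (Bool; true; false)
open import Data.Fin using (Fin)
open import Data.Fin.Subset using (Subset; _∈_; _∪_; _-_; ⁅_⁆; ∣_∣)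
open import Data.Product using (Σ; _×_; ∃; ∃-syntax)
open import Data.Sum using (_⊎_)
open import Relation.Nullary using (¬_)
open import Relation.Binary.PropositionalEquality using (_≡_; _≢_)

record Graph : Set where
  field
    n      : ℕ
    adj    : Fin n → Fin n → Bool
    symm   : ∀ x y → adj x y ≡ adj y x
    irrefl : ∀ x → adj x x ≡ false
open Graph public

Edge : (G : Graph) → Fin (n G) → Fin (n G) → Set
Edge G x y = adj G x y ≡ true

Independent : (G : Graph) → Subset (n G) → Set
Independent G S = ∀ x y → x ∈ S → y ∈ S → ¬ Edge G x y

Dominating : (G : Graph) → Subset (n G) → Set
Dominating G S = ∀ v → v ∈ S ⊎ (∃[ u ] (u ∈ S × Edge G u v))

IndepDominating : (G : Graph) → Subset (n G) → Set
IndepDominating G S = Independent G S × Dominating G S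

IsIDomNumber : Graph → ℕ → Set
IsIDomNumber G k =
  (∃[ S ] (IndepDominating G S × ∣ S ∣ ≡ k)) ×
  (∀ S → IndepDominating G S → k ≤ ∣ S ∣)

IsISet : (G : Graph) → Subset (n G) → Set
IsISet G S = IndepDominating G S × IsIDomNumber G ∣ S ∣

ISetAdj : (G : Graph) → Subset (n G) → Subset (n G) → Set
ISetAdj G S S' =
  S ≢ S' × (∃[ x ] ∃[ y ] (Edge G x y × S' ≡ (S - x) ∪ ⁅ y ⁆))

-- 𝓘(G) ≅ H : a bijection f from V(H) onto the set of i-sets of G
-- preserving and reflecting adjacency.
IGraphIso : (G : Graph) → (H : Graph) → Set
IGraphIso G H =
  Σ (Fin (n H) → Subset (n G)) λ f →
    (∀ a b → f a ≡ f b → a ≡ b) ×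
    (∀ a → IsISet G (f a)) ×
    (∀ S → IsISet G S → ∃[ a ] (f a ≡ S)) ×
    (∀ a b → (Edge H a b → ISetAdj G (f a) (f b)) × (ISetAdj G (f a) (f b) → Edge H a b))

{-# OPTIONS --safe #-}
module Submission where

-- Adding an isolated vertex v to G raises i by one and leaves the i-graph
-- unchanged: v lies in every independent dominating set, so S ↦ S ∪ {v} is a
-- bijection from the i-sets of G onto those of G + v, and two i-sets differ by
-- an edge swap exactly when their images do, since v is never swapped.
-- Adding k − i(G) isolated vertices gives G*.

open import Defs
open import Data.Nat using (ℕ; _≤_; suc; s≤s; s≤s⁻¹; _≤′_; ≤′-refl; ≤′-step)
open import Data.Nat.Properties using (suc-injective; ≤⇒≤′)
open import Data.Product using (Σ; _×_; _,_; proj₁; proj₂; ∃-syntax)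
open import Data.Sum using (inj₁; inj₂)
open import Data.Bool using (Bool; true; false)
open import Data.Fin using (Fin; zero; suc)
open import Data.Fin.Subset using (_∈_; ∣_∣)
open import Data.Vec using (_∷_)
open import Data.Vec.Properties using (∷-injective)
open import Data.Vec.Base using (here; there)
open import Relation.Binary.PropositionalEquality using (_≡_; refl; cong)

addIsolatedVertex : Graph → Graph
addIsolatedVertex G = record { n = suc (n G) ; adj = adj⁺ ; symm = symm⁺ ; irrefl = irrefl⁺ }
  where
  adj⁺ : Fin (suc (n G)) → Fin (suc (n G)) → Bool
  adj⁺ zero    _       = false
  adj⁺ (suc _) zero    = false
  adj⁺ (suc x) (suc y) = adj G x y

  symm⁺ : ∀ x y → adj⁺ x y ≡ adj⁺ y x
  symm⁺ zero    zero    = refl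
  symm⁺ zero    (suc y) = refl
  symm⁺ (suc x) zero    = refl
  symm⁺ (suc x) (suc y) = symm G x y

  irrefl⁺ : ∀ x → adj⁺ x x ≡ false
  irrefl⁺ zero    = refl
  irrefl⁺ (suc x) = irrefl G x

module IsolatedVertex (G : Graph) where

  G⁺ : Graph
  G⁺ = addIsolatedVertex G

  isolated∈indepDominating : ∀ T → IndepDominating G⁺ T → zero ∈ T
  isolated∈indepDominating T (_ , dom) with dom zero
  ... | inj₁ zero∈T              = zero∈T
  ... | inj₂ (zero  , _ , ())
  ... | inj₂ (suc _ , _ , ())

  indepDominating-restrict : ∀ S → IndepDominating G⁺ (true ∷ S) → IndepDominating G S
  indepDominating-restrict S (ind , dom) = ind↓ , dom↓
    where
    ind↓ : Independent G S
    ind↓ x y x∈S y∈S = ind (suc x) (suc y) (there x∈S) (there y∈S)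

    dom↓ : Dominating G S
    dom↓ v with dom (suc v)
    ... | inj₁ (there v∈S)               = inj₁ v∈S
    ... | inj₂ (zero  , _ , ())
    ... | inj₂ (suc u , there u∈S , uv) = inj₂ (u , u∈S , uv)

  indepDominating-extend : ∀ S → IndepDominating G S → IndepDominating G⁺ (true ∷ S)
  indepDominating-extend S (ind , dom) = ind↑ , dom↑
    where
    ind↑ : Independent G⁺ (true ∷ S)
    ind↑ zero    _       _          _          ()
    ind↑ (suc x) zero    _          _          ()
    ind↑ (suc x) (suc y) (there x∈S) (there y∈S) xy = ind x y x∈S y∈S xy

    dom↑ : Dominating G⁺ (true ∷ S)
    dom↑ zero = inj₁ here
    dom↑ (suc v) with dom v
    ... | inj₁ v∈S             = inj₁ (there v∈S)
    ... | inj₂ (u , u∈S , uv) = inj₂ (suc u , there u∈S , uv)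

  isIDomNumber-suc : ∀ m → IsIDomNumber G m → IsIDomNumber G⁺ (suc m)
  isIDomNumber-suc m ((S , idS , ∣S∣≡m) , minimal) =
    (true ∷ S , indepDominating-extend S idS , cong suc ∣S∣≡m) , minimal⁺
    where
    minimal⁺ : ∀ T → IndepDominating G⁺ T → suc m ≤ ∣ T ∣
    minimal⁺ (b ∷ T) idT with isolated∈indepDominating (b ∷ T) idT
    ... | here = s≤s (minimal T (indepDominating-restrict T idT))

  isIDomNumber-pred : ∀ m → IsIDomNumber G⁺ (suc m) → IsIDomNumber G m
  isIDomNumber-pred m ((b ∷ S , idT , ∣T∣≡1+m) , minimal)
    with isolated∈indepDominating (b ∷ S) idT
  ... | here = (S , indepDominating-restrict S idT , suc-injective ∣T∣≡1+m) ,
               λ S′ idS′ → s≤s⁻¹ (minimal (true ∷ S′) (indepDominating-extend S′ idS′))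

  isISet-extend : ∀ S → IsISet G S → IsISet G⁺ (true ∷ S)
  isISet-extend S (idS , num) = indepDominating-extend S idS , isIDomNumber-suc _ num

  isISet-restrict : ∀ S → IsISet G⁺ (true ∷ S) → IsISet G S
  isISet-restrict S (idS , num) = indepDominating-restrict S idS , isIDomNumber-pred _ num

  iSetAdj-extend : ∀ S S′ → ISetAdj G S S′ → ISetAdj G⁺ (true ∷ S) (true ∷ S′)
  iSetAdj-extend S S′ (S≢S′ , x , y , xy , S′≡) =
    (λ eq → S≢S′ (proj₂ (∷-injective eq))) , suc x , suc y , xy , cong (true ∷_) S′≡

  iSetAdj-restrict : ∀ S S′ → ISetAdj G⁺ (true ∷ S) (true ∷ S′) → ISetAdj G S S′
  iSetAdj-restrict S S′ (_ , zero  , _     , () , _)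
  iSetAdj-restrict S S′ (_ , suc x , zero  , () , _)
  iSetAdj-restrict S S′ (S≢S′ , suc x , suc y , xy , S′≡) =
    (λ eq → S≢S′ (cong (true ∷_) eq)) , x , y , xy , proj₂ (∷-injective S′≡)

  iGraphIso-extend : ∀ H → IGraphIso G H → IGraphIso G⁺ H
  iGraphIso-extend H (f , f-inj , f-iSet , f-onto , f-adj) =
    (λ a → true ∷ f a) ,
    (λ a b eq → f-inj a b (proj₂ (∷-injective eq))) ,
    (λ a → isISet-extend (f a) (f-iSet a)) ,
    onto⁺ ,
    λ a b → (λ ab → iSetAdj-extend (f a) (f b) (proj₁ (f-adj a b) ab)) ,
            (λ adj⁺ → proj₂ (f-adj a b) (iSetAdj-restrict (f a) (f b) adj⁺))
    where
    onto⁺ : ∀ T → IsISet G⁺ T → ∃[ a ] (true ∷ f a ≡ T)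
    onto⁺ (b ∷ S) isT with isolated∈indepDominating (b ∷ S) (proj₁ isT)
    ... | here with f-onto S (isISet-restrict S isT)
    ...   | a , fa≡S = a , cong (true ∷_) fa≡S

open IsolatedVertex using (isIDomNumber-suc; iGraphIso-extend)

lemma5p5 : (G H : Graph) (i₀ : ℕ) → IsIDomNumber G i₀ → IGraphIso G H →
    (k : ℕ) → i₀ ≤ k → Σ Graph (λ G* → IsIDomNumber G* k × IGraphIso G* H)
lemma5p5 G H i₀ num iso k i₀≤k = realise (≤⇒≤′ i₀≤k)
  where
  realise : ∀ {k} → i₀ ≤′ k → Σ Graph (λ G* → IsIDomNumber G* k × IGraphIso G* H)
  realise ≤′-refl = G , num , iso
  realise (≤′-step i₀≤k) with realise i₀≤k
  ... | G* , num* , iso* =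
    addIsolatedVertex G* , isIDomNumber-suc G* _ num* , iGraphIso-extend G* H iso*
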